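{- Let $\phi$ be an instance of \textsc{Max (2,3)-SAT} with $n$ variables and let $T_\phi$ be the \textsc{Tournament Value Maximization} instance constructed from $\phi$ as described in the context (the 0/1-valued construction). If $T_\phi$ has a seeding whose tournament value is at least $k'$, then $\phi$ admits an assignment satisfying at least $k'-n$ clauses.
   Context: Tournament model: players are natural numbers forming a set $N$ with $|N|=2^{n'}$; player $i$ beats $j$ iff $i>j$. A seeding is a bijection $\sigma:N\to\{1,\dots,|N|\}$. In round $r=1,\dots,n'$, for each block of $2^r$ consecutive seed positions $\{(t-1)2^r+1,\dots,t2^r\}$, the winner $i_1$ of the first half (its strongest player) plays the winner $i_2$ of the second half with game value $v(i_1,i_2,r)$; the block winner is $\max(i_1,i_2)$. The tournament value is the sum of all game values. \textsc{Max (2,3)-SAT}: a Boolean formula $\phi$ in which each clause has exactly two literals and each variable appears in at most three clauses; the goal is to maximize the number of satisfied clauses. For each variable $x$, fix an order of its appearances in clauses (1st, 2nd, 3rd appearance). Construction of $T_\phi$ from $\phi$ with variables $x_1,\dots,x_n$ and clauses $c_1,\dots,c_m$: for each variable $x$ create players $x,x^T,x^F$; for each clause $c$ a player $c$; let $n'$ be smallest with $16n\le 2^{n'}$, $p=2^{n'}-16n$, and create dummy players $f_1,\dots,f_{13n+p-m}$. Strength order: $x_1>x_1^T>x_1^F>x_2>\dots>x_n>x_n^T>x_n^F>c_1>\dots>c_m>f_1>\dots>f_{13n+p-m}$. The game-value function is symmetric ($v(a,b,r)=v(b,a,r)$) with: $v(x,x^T,1)=v(x,x^F,1)=1$ for each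 variable $x$; if the $j$th appearance of $x$ is in clause $c$, then $v(c,x^T,j)=1$ if $x$ appears non-negated in $c$ and $v(c,x^F,j)=1$ if negated; all other values for rounds $1,\dots,n'$ are $0$. -}

module Defs where

open import Data.Nat using (ℕ; zero; suc; _+_; _*_; _∸_; _^_; _≤_; _<_; _⊔_; _≡ᵇ_)
open import Data.Nat.ListAction using (sum)
open import Data.Fin using (Fin; zero; suc; toℕ; _↑ˡ_; _↑ʳ_)
open import Data.Fin.Properties using () renaming (_≟_ to _≟ᶠ_)
open import Data.Bool using (Bool; true; false; _∧_; _∨_; if_then_else_; not)
open import Data.Product using (_×_; _,_; proj₁; proj₂; Σ; ∃)
open import Data.List using (List; allFin; map)
open import Relation.Nullary.Decidable using (isYes)
open import Relation.Binary.PropositionalEquality using (_≡_)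

-- A literal: a variable together with a polarity (true = non-negated).
Literal : ℕ → Set
Literal n = Fin n × Bool

Formula : ℕ → ℕ → Set
Formula n m = Fin m → Fin 2 → Literal n

litVar : ∀ {n m} → Formula n m → Fin m → Fin 2 → Fin n
litVar φ c b = proj₁ (φ c b)

litPos : ∀ {n m} → Formula n m → Fin m → Fin 2 → Bool
litPos φ c b = proj₂ (φ c b)

-- A fixed order of the appearances of every variable: appearance φ-order
-- assigns to every occurrence (clause c, position b) its appearance number
-- (0-based: 0 = 1st, 1 = 2nd, 2 = 3rd appearance of its variable).
-- Distinct occurrences of the same variable get distinct numbers (so each
-- variable appears at most three times -- the (2,3) restriction), and the
-- numbers used for a variable form an initial segment 1st, 2nd, ...
record AppearanceOrder {n m : ℕ} (φ : Formula n m) : Set where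
  field
    app       : Fin m → Fin 2 → Fin 3
    injective : ∀ c b c' b' → litVar φ c b ≡ litVar φ c' b' →
                app c b ≡ app c' b' → (c , b) ≡ (c' , b')
    initial   : ∀ c b (j : Fin 3) → toℕ j < toℕ (app c b) →
                Σ (Fin m) λ c' → Σ (Fin 2) λ b' →
                  (litVar φ c' b' ≡ litVar φ c b) × (app c' b' ≡ j)
open AppearanceOrder public

Assignment : ℕ → Set
Assignment n = Fin n → Bool

litSat : ∀ {n} → Assignment n → Literal n → Bool
litSat α (x , true)  = α x
litSat α (x , false) = not (α x)

clauseSat : ∀ {n m} → Formula n m → Assignment n → Fin m → Bool
clauseSat φ α c = litSat α (φ c zero) ∨ litSat α (φ c (suc zero))

numSat : ∀ {n m} → Formula n m → Assignment n → ℕ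
numSat {m = m} φ α = sum (map (λ c → if clauseSat φ α c then 1 else 0) (allFin m))

-- A seeded bracket of size 2^r is given by the function
-- (seed position, 0-based) ↦ (player, a natural number; larger beats smaller).
left : ∀ {A : Set} r → (Fin (2 ^ suc r) → A) → Fin (2 ^ r) → A
left r f i = f (i ↑ˡ (2 ^ r + 0))

right : ∀ {A : Set} r → (Fin (2 ^ suc r) → A) → Fin (2 ^ r) → A
right r f i = f (2 ^ r ↑ʳ (i ↑ˡ 0))

winner : ∀ r → (Fin (2 ^ r) → ℕ) → ℕ
winner zero    f = f zero
winner (suc r) f = winner r (left r f) ⊔ winner r (right r f)

blockValue : (ℕ → ℕ → ℕ → ℕ) → ∀ r → (Fin (2 ^ r) → ℕ) → ℕ
blockValue v zero    f = 0
blockValue v (suc r) f =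
  blockValue v r (left r f) + blockValue v r (right r f)
  + v (winner r (left r f)) (winner r (right r f)) (suc r)

IsDepth : ℕ → ℕ → Set
IsDepth n n' = (16 * n ≤ 2 ^ n') × (∀ k → 16 * n ≤ 2 ^ k → n' ≤ k)

-- Roles of the players of T_φ:
-- var x 0 = x, var x 1 = x^T, var x 2 = x^F, cl c = clause player c,
-- dummy = some f_i.
data Role (n m : ℕ) : Set where
  var   : Fin n → Fin 3 → Role n m
  cl    : Fin m → Role n m
  dummy : Role n m

liftVar : ∀ {n m} → Role n m → Role (suc n) m
liftVar (var x k) = var (suc x) k
liftVar (cl c)    = cl c
liftVar dummy     = dummy

liftCl : ∀ {n m} → Role n m → Role n (suc m)
liftCl (var x k) = var x k
liftCl (cl c)    = cl (suc c)
liftCl dummy     = dummy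

decodeCl : ∀ {n} m → ℕ → Role n m
decodeCl zero    q       = dummy
decodeCl (suc m) zero    = cl zero
decodeCl (suc m) (suc q) = liftCl (decodeCl m q)

-- Role of the player at position q (0-based) in the strength order
-- x_1 > x_1^T > x_1^F > ... > x_n^F > c_1 > ... > c_m > f_1 > ...
decode : ∀ n m → ℕ → Role n m
decode zero    m q                   = decodeCl m q
decode (suc n) m zero                = var zero zero
decode (suc n) m (suc zero)          = var zero (suc zero)
decode (suc n) m (suc (suc zero))    = var zero (suc (suc zero))
decode (suc n) m (suc (suc (suc q))) = liftVar (decode n m q)

-- Players are the numbers 0 .. 2^n' - 1 (i beats j iff i > j); the player
-- with number a is at position 2^n' - 1 - a of the strength order.
roleOf : ∀ n m (n' : ℕ) → ℕ → Role n m
roleOf n m n' a = decode n m (2 ^ n' ∸ 1 ∸ a)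

-- Does clause c contain variable x, with polarity `pos`, at its j-th
-- appearance (j 1-based, i.e. the round number)?
clauseHas : ∀ {n m} (φ : Formula n m) → AppearanceOrder φ →
            Fin m → Fin n → Bool → ℕ → Bool
clauseHas φ ord c x pos r = occ zero ∨ occ (suc zero)
  where
  occ : Fin 2 → Bool
  occ b = isYes (litVar φ c b ≟ᶠ x)
        ∧ (if pos then litPos φ c b else not (litPos φ c b))
        ∧ (r ≡ᵇ suc (toℕ (app ord c b)))

edge : ∀ {n m} (φ : Formula n m) → AppearanceOrder φ →
       Role n m → Role n m → ℕ → Bool
edge φ ord (var x zero) (var y (suc zero))       r =
  isYes (x ≟ᶠ y) ∧ (r ≡ᵇ 1)
edge φ ord (var x zero) (var y (suc (suc zero))) r =
  isYes (x ≟ᶠ y) ∧ (r ≡ᵇ 1)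
edge φ ord (cl c) (var x (suc zero))       r = clauseHas φ ord c x true r
edge φ ord (cl c) (var x (suc (suc zero))) r = clauseHas φ ord c x false r
edge φ ord _ _ r = false

gameValue : ∀ {n m} (φ : Formula n m) → AppearanceOrder φ →
            (n' : ℕ) → ℕ → ℕ → ℕ → ℕ
gameValue {n} {m} φ ord n' a b r =
  if edge φ ord A B r ∨ edge φ ord B A r then 1 else 0
  where
  A = roleOf n m n' a
  B = roleOf n m n' b

-- tournament value of T_φ under a seeding σ : players → seed positions
-- (both sides identified with Fin 2^n', players by their numbers)
tournamentValue : ∀ {n m} (φ : Formula n m) → AppearanceOrder φ →
                  (n' : ℕ) → (Fin (2 ^ n') → Fin (2 ^ n')) → ℕ
tournamentValue φ ord n' playerAt =
  blockValue (gameValue φ ord n') n' (λ s → toℕ (playerAt s))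

-- In a knockout bracket with distinct players a player keeps playing until it loses, so two
-- different matches sharing a player lie in different rounds and that player won the earlier one.
-- A value-one game of T_φ pits x against x^T or x^F in round 1, or a clause c against the literal
-- player of one of its occurrences in the round given by that occurrence's appearance number;
-- clause players are weaker than literal players, which are weaker than variable players.
-- Charge each value-one game to its clause when the literal is satisfied, and to its variable
-- otherwise. Making x true iff x^T plays value-one clause games at two distinct appearances or x^F
-- plays none makes the charging injective: a clause player loses its only value-one game, x plays
-- a single round-1 game, a literal player beaten by x in round 1 plays nothing else, and as x has
-- only three appearances x^T and x^F cannot both play twice. So the value is at most n plus the
-- number of satisfied clauses.
module Submission where

open import Defs
open import Data.Nat using (ℕ; zero; suc; _+_; _*_; _∸_; _^_; _≤_; _<_; _⊔_; _≡ᵇ_; z≤n; s≤s)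
open import Data.Nat.Properties
open import Data.Nat.ListAction using (sum)
open import Data.Nat.ListAction.Properties using (sum-++)
open import Data.Nat.Tactic.RingSolver using (solve-∀)
open import Data.Fin using (Fin; zero; suc; toℕ; _↑ˡ_; _↑ʳ_) renaming (_<_ to _<ᶠ_)
open import Data.Fin.Properties
  using (toℕ-↑ˡ; toℕ-↑ʳ; ↑ˡ-injective; ↑ʳ-injective; toℕ<n; toℕ-injective; pigeonhole; any?)
  renaming (_≟_ to _≟ᶠ_)
open import Data.Bool using (Bool; true; false; not; _∧_; _∨_; if_then_else_; T)
open import Data.Bool.Properties using (T-≡; T-not-≡; T-∧; T-∨; ¬-not; not-injective) renaming (_≟_ to _≟ᵇ_)
open import Data.Product using (Σ; _×_; _,_; proj₁; proj₂; ∃-syntax)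
open import Data.Sum using (_⊎_; inj₁; inj₂; swap)
open import Data.Sum.Properties using (inj₁-injective; inj₂-injective; ≡-dec)
open import Data.Empty using (⊥; ⊥-elim)
open import Data.List using (List; []; _∷_; _++_; [_]; map; filter; allFin; length)
open import Data.List.Properties using (map-++; filter-notAll; length-++; length-map; length-tabulate)
open import Data.List.Membership.Propositional using (_∈_; find; lose)
open import Data.List.Membership.Propositional.Properties
  using (∈-++⁻; ∈-++⁺ˡ; ∈-++⁺ʳ; ∈-map⁺; ∈-allFin; ∈-filter⁺; ∈-filter⁻)
open import Data.List.Relation.Unary.Any as Any using (here; there)
open import Data.List.Relation.Unary.All as All using (All; []; _∷_)
open import Data.List.Relation.Unary.AllPairs as AllPairs using (AllPairs; []; _∷_)
import Data.List.Relation.Unary.AllPairs.Properties as AllPairsₚ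
open import Data.List.Relation.Unary.Unique.Propositional using (Unique)
open import Data.List.Relation.Unary.Unique.Propositional.Properties using (filter⁺)
open import Function using (_∘_; id)
open import Function.Bundles using (Equivalence; Injection; _↔_; Inverse)
open import Function.Definitions using (Injective)
open import Function.Properties.Inverse using (↔-sym; ↔⇒↣)
open import Relation.Binary.Definitions using (DecidableEquality)
open import Relation.Binary.PropositionalEquality
  using (_≡_; _≢_; refl; sym; trans; cong; cong₂; subst; subst₂; module ≡-Reasoning)
open import Relation.Nullary using (¬_; Dec; yes; no)
open import Relation.Nullary.Decidable
  using (isYes; toWitness; toWitnessFalse; decidable-stable; map′; ¬?; T?; _×-dec_; _⊎-dec_)

record Match : Set where
  constructor match
  field
    home away round : ℕ
open Match public

victor : Match → ℕ
victor g = home g ⊔ away g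

Plays : ℕ → Match → Set
Plays p g = p ≡ home g ⊎ p ≡ away g

data Joins (u w : ℕ) (g : Match) : Set where
  home-away : home g ≡ u → away g ≡ w → Joins u w g
  away-home : home g ≡ w → away g ≡ u → Joins u w g

module _ {u w : ℕ} {g : Match} where

  joins-swap : Joins u w g → Joins w u g
  joins-swap (home-away h a) = away-home h a
  joins-swap (away-home h a) = home-away h a

  joins-plays₁ : Joins u w g → Plays u g
  joins-plays₁ (home-away refl _) = inj₁ refl
  joins-plays₁ (away-home _ refl) = inj₂ refl

  joins-plays₂ : Joins u w g → Plays w g
  joins-plays₂ (home-away _ refl) = inj₂ refl
  joins-plays₂ (away-home refl _) = inj₁ refl

  joins-players : Joins u w g → ∀ {p} → Plays p g → p ≡ u ⊎ p ≡ w
  joins-players (home-away refl refl) p∈g = p∈g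
  joins-players (away-home refl refl) p∈g = swap p∈g

  weaker-loses : Joins u w g → u < w → u ≢ victor g
  weaker-loses (home-away refl refl) u<w u≡ = <-irrefl (trans u≡ (m≤n⇒m⊔n≡n (<⇒≤ u<w))) u<w
  weaker-loses (away-home refl refl) u<w u≡ = <-irrefl (trans u≡ (m≥n⇒m⊔n≡m (<⇒≤ u<w))) u<w

matchValue : (ℕ → ℕ → ℕ → ℕ) → Match → ℕ
matchValue v g = v (home g) (away g) (round g)

finalMatch : ∀ r → (Fin (2 ^ suc r) → ℕ) → Match
finalMatch r f = match (winner r (left r f)) (winner r (right r f)) (suc r)

matches : ∀ r → (Fin (2 ^ r) → ℕ) → List Match
matches zero    f = []
matches (suc r) f = matches r (left r f) ++ matches r (right r f) ++ [ finalMatch r f ]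

sum-map-++ : ∀ {A : Set} (h : A → ℕ) xs ys → sum (map h (xs ++ ys)) ≡ sum (map h xs) + sum (map h ys)
sum-map-++ h xs ys = trans (cong sum (map-++ h xs ys)) (sum-++ (map h xs) (map h ys))

blockValue≡sum-matches : ∀ v r f → blockValue v r f ≡ sum (map (matchValue v) (matches r f))
blockValue≡sum-matches v zero    f = refl
blockValue≡sum-matches v (suc r) f = begin
    blockValue v r L + blockValue v r R + final
  ≡⟨ cong₂ (λ a b → a + b + final) (blockValue≡sum-matches v r L) (blockValue≡sum-matches v r R) ⟩
    total (matches r L) + total (matches r R) + final
  ≡⟨ +-assoc (total (matches r L)) _ _ ⟩
    total (matches r L) + (total (matches r R) + final)
  ≡⟨ cong (λ z → total (matches r L) + (total (matches r R) + z)) (sym (+-identityʳ final)) ⟩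
    total (matches r L) + (total (matches r R) + total [ finalMatch r f ])
  ≡⟨ cong (total (matches r L) +_) (sym (sum-map-++ (matchValue v) (matches r R) _)) ⟩
    total (matches r L) + total (matches r R ++ [ finalMatch r f ])
  ≡⟨ sym (sum-map-++ (matchValue v) (matches r L) _) ⟩
    total (matches (suc r) f)
  ∎
  where
  open ≡-Reasoning
  L R : Fin (2 ^ r) → ℕ
  L = left r f
  R = right r f
  final : ℕ
  final = matchValue v (finalMatch r f)
  total : List Match → ℕ
  total gs = sum (map (matchValue v) gs)

Seeded : ∀ r → (Fin (2 ^ r) → ℕ) → ℕ → Set
Seeded r f p = ∃[ s ] f s ≡ p

module Halves (r : ℕ) (f : Fin (2 ^ suc r) → ℕ) where

  L R : Fin (2 ^ r) → ℕ
  L = left r f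
  R = right r f

  seeded-left : ∀ {p} → Seeded r L p → Seeded (suc r) f p
  seeded-left (s , e) = s ↑ˡ (2 ^ r + 0) , e

  seeded-right : ∀ {p} → Seeded r R p → Seeded (suc r) f p
  seeded-right (s , e) = 2 ^ r ↑ʳ (s ↑ˡ 0) , e

  data SplitMatch : Match → Set where
    in-left  : ∀ {g} → g ∈ matches r L → SplitMatch g
    in-right : ∀ {g} → g ∈ matches r R → SplitMatch g
    is-final : SplitMatch (finalMatch r f)

  split-matches : ∀ {g} → g ∈ matches (suc r) f → SplitMatch g
  split-matches g∈ with ∈-++⁻ (matches r L) g∈
  ... | inj₁ g∈L = in-left g∈L
  ... | inj₂ g∈ with ∈-++⁻ (matches r R) g∈
  ...   | inj₁ g∈R = in-right g∈R
  ...   | inj₂ (here refl) = is-final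

  module _ (f-injective : Injective _≡_ _≡_ f) where

    halves-disjoint : ∀ {p} → Seeded r L p → Seeded r R p → ⊥
    halves-disjoint (s , refl) (t , e) = <-irrefl (sym (cong toℕ (f-injective e))) (begin-strict
        toℕ (s ↑ˡ (2 ^ r + 0))   ≡⟨ toℕ-↑ˡ s _ ⟩
        toℕ s                    <⟨ toℕ<n s ⟩
        2 ^ r                    ≤⟨ m≤m+n (2 ^ r) _ ⟩
        2 ^ r + toℕ (t ↑ˡ 0)     ≡⟨ toℕ-↑ʳ (2 ^ r) (t ↑ˡ 0) ⟨
        toℕ (2 ^ r ↑ʳ (t ↑ˡ 0)) ∎)
      where open ≤-Reasoning

    left-injective : Injective _≡_ _≡_ L
    left-injective e = ↑ˡ-injective _ _ _ (f-injective e)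

    right-injective : Injective _≡_ _≡_ R
    right-injective e = ↑ˡ-injective 0 _ _ (↑ʳ-injective (2 ^ r) _ _ (f-injective e))

open Halves using (SplitMatch; in-left; in-right; is-final; split-matches)

winner-seeded : ∀ r f → Seeded r f (winner r f)
winner-seeded zero    f = zero , refl
winner-seeded (suc r) f with ⊔-sel (winner r (left r f)) (winner r (right r f))
... | inj₁ e rewrite e = Halves.seeded-left r f (winner-seeded r (left r f))
... | inj₂ e rewrite e = Halves.seeded-right r f (winner-seeded r (right r f))

players-seeded : ∀ r f {g p} → g ∈ matches r f → Plays p g → Seeded r f p
players-seeded (suc r) f g∈ p∈g with split-matches r f g∈
... | in-left g∈L  = Halves.seeded-left r f (players-seeded r (left r f) g∈L p∈g)
... | in-right g∈R = Halves.seeded-right r f (players-seeded r (right r f) g∈R p∈g)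
... | is-final with p∈g
...   | inj₁ refl = Halves.seeded-left r f (winner-seeded r (left r f))
...   | inj₂ refl = Halves.seeded-right r f (winner-seeded r (right r f))

round≤depth : ∀ r f {g} → g ∈ matches r f → round g ≤ r
round≤depth (suc r) f g∈ with split-matches r f g∈
... | in-left g∈L  = m≤n⇒m≤1+n (round≤depth r (left r f) g∈L)
... | in-right g∈R = m≤n⇒m≤1+n (round≤depth r (right r f) g∈R)
... | is-final     = ≤-refl

winner-is-victor : ∀ r f → Injective _≡_ _≡_ f → ∀ {g} → g ∈ matches r f →
                   Plays (winner r f) g → winner r f ≡ victor g
winner-is-victor (suc r) f f-inj g∈ = go (split-matches r f g∈) (⊔-sel (winner r L) (winner r R))
  where
  open Halves r f using (L; R; left-injective; right-injective; halves-disjoint)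
  W : ℕ
  W = winner (suc r) f
  go : ∀ {g} → SplitMatch r f g → W ≡ winner r L ⊎ W ≡ winner r R → Plays W g → W ≡ victor g
  go {g} (in-left g∈L) (inj₁ e) w∈g =
    trans e (winner-is-victor r L (left-injective f-inj) g∈L (subst (λ q → Plays q g) e w∈g))
  go {g} (in-left g∈L) (inj₂ e) w∈g = ⊥-elim (halves-disjoint f-inj
    (players-seeded r L g∈L (subst (λ q → Plays q g) e w∈g)) (winner-seeded r R))
  go {g} (in-right g∈R) (inj₁ e) w∈g = ⊥-elim (halves-disjoint f-inj
    (winner-seeded r L) (players-seeded r R g∈R (subst (λ q → Plays q g) e w∈g)))
  go {g} (in-right g∈R) (inj₂ e) w∈g =
    trans e (winner-is-victor r R (right-injective f-inj) g∈R (subst (λ q → Plays q g) e w∈g))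
  go is-final _ _ = refl

Earlier : ℕ → Match → Match → Set
Earlier p g h = round g < round h × p ≡ victor g

Compatible : Match → Match → Set
Compatible g h = g ≢ h × (∀ {p} → Plays p g → Plays p h → Earlier p g h ⊎ Earlier p h g)

matches-compatible : ∀ r f → Injective _≡_ _≡_ f → AllPairs Compatible (matches r f)
matches-compatible zero    f f-inj = []
matches-compatible (suc r) f f-inj =
  AllPairsₚ.++⁺ (matches-compatible r L (left-injective f-inj))
    (AllPairsₚ.++⁺ (matches-compatible r R (right-injective f-inj)) ([] ∷ [])
      (All.tabulate λ h∈R → before-final-right h∈R ∷ []))
    (All.tabulate λ g∈L → All.tabulate λ h∈ → left-vs-later g∈L (∈-++⁻ (matches r R) h∈))
  where
  open Halves r f using (L; R; left-injective; right-injective; halves-disjoint)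
  final : Match
  final = finalMatch r f

  not-final : ∀ {g} → round g ≤ r → g ≢ final
  not-final g≤r refl = 1+n≰n g≤r

  across-halves : ∀ {g h} → g ∈ matches r L → h ∈ matches r R → Compatible g h
  across-halves g∈L h∈R =
    (λ { refl → halves-disjoint f-inj (players-seeded r L g∈L (inj₁ refl)) (players-seeded r R h∈R (inj₁ refl)) }) ,
    λ p∈g p∈h → ⊥-elim (halves-disjoint f-inj (players-seeded r L g∈L p∈g) (players-seeded r R h∈R p∈h))

  before-final-left : ∀ {g} → g ∈ matches r L → Compatible g final
  before-final-left {g} g∈L = not-final (round≤depth r L g∈L) , λ where
    p∈g (inj₁ refl) → inj₁ (s≤s (round≤depth r L g∈L) , winner-is-victor r L (left-injective f-inj) g∈L p∈g)
    p∈g (inj₂ refl) → ⊥-elim (halves-disjoint f-inj (players-seeded r L g∈L p∈g) (winner-seeded r R))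

  before-final-right : ∀ {g} → g ∈ matches r R → Compatible g final
  before-final-right {g} g∈R = not-final (round≤depth r R g∈R) , λ where
    p∈g (inj₂ refl) → inj₁ (s≤s (round≤depth r R g∈R) , winner-is-victor r R (right-injective f-inj) g∈R p∈g)
    p∈g (inj₁ refl) → ⊥-elim (halves-disjoint f-inj (winner-seeded r L) (players-seeded r R g∈R p∈g))

  left-vs-later : ∀ {g h} → g ∈ matches r L → h ∈ matches r R ⊎ h ∈ [ final ] → Compatible g h
  left-vs-later g∈L (inj₁ h∈R)       = across-halves g∈L h∈R
  left-vs-later g∈L (inj₂ (here refl)) = before-final-left g∈L

allPairs-lookup : ∀ {A : Set} {R : A → A → Set} {xs : List A} → AllPairs R xs →
                  ∀ {x y} → x ∈ xs → y ∈ xs → x ≡ y ⊎ R x y ⊎ R y x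
allPairs-lookup (_  ∷ _)  (here refl) (here refl) = inj₁ refl
allPairs-lookup (Rx ∷ _)  (here refl) (there y∈)  = inj₂ (inj₁ (All.lookup Rx y∈))
allPairs-lookup (Rx ∷ _)  (there x∈)  (here refl) = inj₂ (inj₂ (All.lookup Rx x∈))
allPairs-lookup (_  ∷ Rs) (there x∈)  (there y∈)  = allPairs-lookup Rs x∈ y∈

module Bracket (r : ℕ) (f : Fin (2 ^ r) → ℕ) (f-injective : Injective _≡_ _≡_ f) where

  matches-unique : Unique (matches r f)
  matches-unique = AllPairs.map proj₁ (matches-compatible r f f-injective)

  common-player : ∀ {g h p} → g ∈ matches r f → h ∈ matches r f → Plays p g → Plays p h →
                  g ≡ h ⊎ Earlier p g h ⊎ Earlier p h g
  common-player g∈ h∈ p∈g p∈h with allPairs-lookup (matches-compatible r f f-injective) g∈ h∈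
  ... | inj₁ g≡h            = inj₁ g≡h
  ... | inj₂ (inj₁ (_ , c)) = inj₂ (c p∈g p∈h)
  ... | inj₂ (inj₂ (_ , c)) = inj₂ (swap (c p∈h p∈g))

  same-round⇒≡ : ∀ {g h p} → g ∈ matches r f → h ∈ matches r f → Plays p g → Plays p h →
                 round g ≡ round h → g ≡ h
  same-round⇒≡ g∈ h∈ p∈g p∈h e with common-player g∈ h∈ p∈g p∈h
  ... | inj₁ g≡h             = g≡h
  ... | inj₂ (inj₁ (g<h , _)) = ⊥-elim (<-irrefl e g<h)
  ... | inj₂ (inj₂ (h<g , _)) = ⊥-elim (<-irrefl (sym e) h<g)

  beaten-in-later⇒≡ : ∀ {g h p} → g ∈ matches r f → h ∈ matches r f → Plays p g → Plays p h →
                      p ≢ victor g → round g ≤ round h → g ≡ h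
  beaten-in-later⇒≡ g∈ h∈ p∈g p∈h p-loses g≤h with common-player g∈ h∈ p∈g p∈h
  ... | inj₁ g≡h             = g≡h
  ... | inj₂ (inj₁ (_ , p≡)) = ⊥-elim (p-loses p≡)
  ... | inj₂ (inj₂ (h<g , _)) = ⊥-elim (<⇒≱ h<g g≤h)

  beaten-twice⇒≡ : ∀ {g h p} → g ∈ matches r f → h ∈ matches r f → Plays p g → Plays p h →
                   p ≢ victor g → p ≢ victor h → g ≡ h
  beaten-twice⇒≡ g∈ h∈ p∈g p∈h g-loss h-loss with common-player g∈ h∈ p∈g p∈h
  ... | inj₁ g≡h             = g≡h
  ... | inj₂ (inj₁ (_ , p≡)) = ⊥-elim (g-loss p≡)
  ... | inj₂ (inj₂ (_ , p≡)) = ⊥-elim (h-loss p≡)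

sum-indicator≡length-filter : ∀ {A : Set} (b : A → Bool) xs →
  sum (map (λ x → if b x then 1 else 0) xs) ≡ length (filter (T? ∘ b) xs)
sum-indicator≡length-filter b []       = refl
sum-indicator≡length-filter b (x ∷ xs) with b x
... | true  = cong suc (sum-indicator≡length-filter b xs)
... | false = sum-indicator≡length-filter b xs

injection⇒length≤ : ∀ {A B : Set} → DecidableEquality B → {xs : List A} {ys : List B} → Unique xs →
  (f : ∀ {x} → x ∈ xs → B) → (∀ {x y} (i : x ∈ xs) (j : y ∈ xs) → f i ≡ f j → x ≡ y) →
  (∀ {x} (i : x ∈ xs) → f i ∈ ys) → length xs ≤ length ys
injection⇒length≤ _≟_ {[]}     _                      f f-inj f∈ = z≤n
injection⇒length≤ _≟_ {x ∷ xs} {ys} (x∉xs ∷ xs-unique) f f-inj f∈ = begin-strict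
    length xs
  ≤⟨ injection⇒length≤ _≟_ xs-unique (f ∘ there) (λ i j → f-inj (there i) (there j))
       (λ i → ∈-filter⁺ distinct? (f∈ (there i)) (distinct i)) ⟩
    length (filter distinct? ys)
  <⟨ filter-notAll distinct? ys (Any.map (λ e ne → ne e) (f∈ (here refl))) ⟩
    length ys
  ∎
  where
  open ≤-Reasoning
  distinct? : ∀ y → Dec (f (here refl) ≢ y)
  distinct? y = ¬? (f (here refl) ≟ y)
  distinct : ∀ {y} (j : y ∈ xs) → f (here refl) ≢ f (there j)
  distinct j e = All.lookup x∉xs j (f-inj (here refl) (there j) e)

literalSide : Bool → Fin 3
literalSide true  = suc zero
literalSide false = suc (suc zero)

literalRole : ∀ {n m} → Fin n → Bool → Role n m
literalRole x p = var x (literalSide p)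

literalRole-injective : ∀ {n m} {x y : Fin n} {p q} →
                        literalRole {m = m} x p ≡ literalRole y q → x ≡ y × p ≡ q
literalRole-injective {p = true}  {true}  refl = refl , refl
literalRole-injective {p = false} {false} refl = refl , refl

_≟ʳ_ : ∀ {n m} → DecidableEquality (Role n m)
var x t ≟ʳ var y s = map′ (λ (x≡y , t≡s) → cong₂ var x≡y t≡s) (λ { refl → refl , refl }) (x ≟ᶠ y ×-dec t ≟ᶠ s)
cl c    ≟ʳ cl d    = map′ (cong cl) (λ { refl → refl }) (c ≟ᶠ d)
dummy   ≟ʳ dummy   = yes refl
var _ _ ≟ʳ cl _    = no λ ()
var _ _ ≟ʳ dummy   = no λ ()
cl _    ≟ʳ var _ _ = no λ ()
cl _    ≟ʳ dummy   = no λ ()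
dummy   ≟ʳ var _ _ = no λ ()
dummy   ≟ʳ cl _    = no λ ()

decodeCl≢var : ∀ {n} m q {x : Fin n} {t} → decodeCl m q ≢ var x t
decodeCl≢var {n} (suc m) (suc q) e with decodeCl {n} m q in eq
... | var _ _ = decodeCl≢var m q eq
decodeCl≢var (suc m) (suc q) () | cl _
decodeCl≢var (suc m) (suc q) () | dummy

decodeCl-cl : ∀ {n} m q {c} → decodeCl {n} m q ≡ cl c → q ≡ toℕ c
decodeCl-cl (suc m) zero    refl = refl
decodeCl-cl {n} (suc m) (suc q) e with decodeCl {n} m q in eq
... | var _ _ = ⊥-elim (decodeCl≢var m q eq)
decodeCl-cl (suc m) (suc q) refl | cl _ = cong suc (decodeCl-cl m q eq)
decodeCl-cl (suc m) (suc q) ()   | dummy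

3*suc : ∀ a b → 3 * suc a + b ≡ suc (suc (suc (3 * a + b)))
3*suc = solve-∀

decode-var : ∀ n m q {x : Fin n} {t} → decode n m q ≡ var x t → q ≡ 3 * toℕ x + toℕ t
decode-var zero    m q                   e    = ⊥-elim (decodeCl≢var m q e)
decode-var (suc n) m zero                refl = refl
decode-var (suc n) m (suc zero)          refl = refl
decode-var (suc n) m (suc (suc zero))    refl = refl
decode-var (suc n) m (suc (suc (suc q))) e with decode n m q in eq
decode-var (suc n) m (suc (suc (suc q))) refl | var y u =
  trans (cong (λ z → suc (suc (suc z))) (decode-var n m q eq)) (sym (3*suc (toℕ y) (toℕ u)))

decode-cl : ∀ n m q {c} → decode n m q ≡ cl c → q ≡ 3 * n + toℕ c
decode-cl zero    m q                   e = decodeCl-cl m q e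
decode-cl (suc n) m (suc (suc (suc q))) e with decode n m q in eq
decode-cl (suc n) m (suc (suc (suc q))) refl | cl c =
  trans (cong (λ z → suc (suc (suc z))) (decode-cl n m q eq)) (sym (3*suc n (toℕ c)))

module Strength (n m n' : ℕ) where

  N : ℕ
  N = 2 ^ n'

  role : ℕ → Role n m
  role = roleOf n m n'

  rank : ℕ → ℕ
  rank a = N ∸ 1 ∸ a

  rank-injective : ∀ {a b} → a < N → b < N → rank a ≡ rank b → a ≡ b
  rank-injective a<N b<N = ∸-cancelˡ-≡ (∸-monoˡ-≤ 1 a<N) (∸-monoˡ-≤ 1 b<N)

  same-var-role⇒≡ : ∀ {a b x t} → a < N → b < N → role a ≡ var x t → role b ≡ var x t → a ≡ b
  same-var-role⇒≡ a<N b<N ra rb =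
    rank-injective a<N b<N (trans (decode-var n m _ ra) (sym (decode-var n m _ rb)))

  same-clause-role⇒≡ : ∀ {a b c} → a < N → b < N → role a ≡ cl c → role b ≡ cl c → a ≡ b
  same-clause-role⇒≡ a<N b<N ra rb =
    rank-injective a<N b<N (trans (decode-cl n m _ ra) (sym (decode-cl n m _ rb)))

  variable-beats-literal : ∀ {a b x p} → role a ≡ var x zero → role b ≡ literalRole x p → b < a
  variable-beats-literal {a} {b} {x} {p} ra rb = ∸-cancelʳ-< (begin-strict
      rank a                                ≡⟨ decode-var n m _ ra ⟩
      3 * toℕ x + 0                         <⟨ +-monoʳ-< (3 * toℕ x) (side>0 p) ⟩
      3 * toℕ x + toℕ (literalSide p)       ≡⟨ decode-var n m _ rb ⟨
      rank b                                ∎)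
    where
    open ≤-Reasoning
    side>0 : ∀ p → 0 < toℕ (literalSide p)
    side>0 true  = s≤s z≤n
    side>0 false = s≤s z≤n

  literal-beats-clause : ∀ {a b c x t} → role a ≡ cl c → role b ≡ var x t → a < b
  literal-beats-clause {a} {b} {c} {x} {t} ra rb = ∸-cancelʳ-< (begin-strict
      rank b                ≡⟨ decode-var n m _ rb ⟩
      3 * toℕ x + toℕ t     <⟨ +-monoʳ-< (3 * toℕ x) (toℕ<n t) ⟩
      3 * toℕ x + 3         ≡⟨ +-comm (3 * toℕ x) 3 ⟩
      3 + 3 * toℕ x         ≡⟨ *-suc 3 (toℕ x) ⟨
      3 * suc (toℕ x)       ≤⟨ *-monoʳ-≤ 3 (toℕ<n x) ⟩
      3 * n                 ≤⟨ m≤m+n (3 * n) (toℕ c) ⟩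
      3 * n + toℕ c         ≡⟨ decode-cl n m _ ra ⟨
      rank a                ∎)
    where open ≤-Reasoning

module Games {n m : ℕ} (φ : Formula n m) (ord : AppearanceOrder φ) (n' : ℕ) where

  open Strength n m n'

  -- `gameValue φ ord n' a b r` unfolds to `if isValueOne (match a b r) then 1 else 0`.
  isValueOne : Match → Bool
  isValueOne g = edge φ ord (role (home g)) (role (away g)) (round g)
               ∨ edge φ ord (role (away g)) (role (home g)) (round g)

  occurrenceRound : Fin m → Fin 2 → ℕ
  occurrenceRound c b = suc (toℕ (app ord c b))

  occurrenceRole : Fin m → Fin 2 → Role n m
  occurrenceRole c b = literalRole (litVar φ c b) (litPos φ c b)

  data Edge (A B : Role n m) (r : ℕ) : Set where
    variable-edge : ∀ x p → A ≡ var x zero → B ≡ literalRole x p → r ≡ 1 → Edge A B r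
    clause-edge   : ∀ c b → A ≡ cl c → B ≡ occurrenceRole c b → r ≡ occurrenceRound c b → Edge A B r

  polarity : ∀ pos l → T (if pos then l else not l) → l ≡ pos
  polarity true  true  _ = refl
  polarity false false _ = refl

  -- The hypothesis is the summand `occ b` of `clauseHas`.
  occurrence-sound : ∀ c b x pos r →
    T (isYes (litVar φ c b ≟ᶠ x) ∧ (if pos then litPos φ c b else not (litPos φ c b))
       ∧ (r ≡ᵇ occurrenceRound c b)) →
    litVar φ c b ≡ x × litPos φ c b ≡ pos × r ≡ occurrenceRound c b
  occurrence-sound c b x pos r h with Equivalence.to (T-∧ {isYes (litVar φ c b ≟ᶠ x)}) h
  ... | var≡ , h′ with Equivalence.to (T-∧ {if pos then litPos φ c b else not (litPos φ c b)}) h′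
  ...   | pos≡ , round≡ =
    toWitness {a? = litVar φ c b ≟ᶠ x} var≡ , polarity pos _ pos≡ , ≡ᵇ⇒≡ r _ round≡

  clauseHas-sound : ∀ c x pos r → T (clauseHas φ ord c x pos r) →
                    ∃[ b ] litVar φ c b ≡ x × litPos φ c b ≡ pos × r ≡ occurrenceRound c b
  clauseHas-sound c x pos r h with Equivalence.to T-∨ h
  ... | inj₁ h₀ = zero , occurrence-sound c zero x pos r h₀
  ... | inj₂ h₁ = suc zero , occurrence-sound c (suc zero) x pos r h₁

  edge-sound : ∀ A B r → T (edge φ ord A B r) → Edge A B r
  edge-sound (var x zero) (var y (suc zero)) r h with Equivalence.to (T-∧ {isYes (x ≟ᶠ y)}) h
  ... | x≡y , round≡ rewrite toWitness {a? = x ≟ᶠ y} x≡y = variable-edge y true refl refl (≡ᵇ⇒≡ r 1 round≡)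
  edge-sound (var x zero) (var y (suc (suc zero))) r h with Equivalence.to (T-∧ {isYes (x ≟ᶠ y)}) h
  ... | x≡y , round≡ rewrite toWitness {a? = x ≟ᶠ y} x≡y = variable-edge y false refl refl (≡ᵇ⇒≡ r 1 round≡)
  edge-sound (cl c) (var x (suc zero)) r h with clauseHas-sound c x true r h
  ... | b , var≡ , pos≡ , round≡ = clause-edge c b refl (sym (cong₂ literalRole var≡ pos≡)) round≡
  edge-sound (cl c) (var x (suc (suc zero))) r h with clauseHas-sound c x false r h
  ... | b , var≡ , pos≡ , round≡ = clause-edge c b refl (sym (cong₂ literalRole var≡ pos≡)) round≡
  edge-sound (var x zero)    (var y zero) r ()
  edge-sound (var x zero)    (cl _)       r ()
  edge-sound (var x zero)    dummy        r ()
  edge-sound (var x (suc _)) B            r ()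
  edge-sound (cl c)          (var x zero) r ()
  edge-sound (cl c)          (cl _)       r ()
  edge-sound (cl c)          dummy        r ()
  edge-sound dummy           B            r ()

  record Realises (A B : Role n m) (r : ℕ) (g : Match) : Set where
    constructor realises
    field
      u w    : ℕ
      joins  : Joins u w g
      u-role : role u ≡ A
      w-role : role w ≡ B
      round≡ : round g ≡ r

  data ValueOneMatch (g : Match) : Set where
    variable-match : ∀ x p → Realises (var x zero) (literalRole x p) 1 g → ValueOneMatch g
    clause-match   : ∀ c b → Realises (cl c) (occurrenceRole c b) (occurrenceRound c b) g → ValueOneMatch g

  from-edge : ∀ {u w g} → Joins u w g → Edge (role u) (role w) (round g) → ValueOneMatch g
  from-edge J (variable-edge x p eA eB er) = variable-match x p (realises _ _ J eA eB er)
  from-edge J (clause-edge c b eA eB er)   = clause-match c b (realises _ _ J eA eB er)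

  classify : ∀ g → T (isValueOne g) → ValueOneMatch g
  classify g v with Equivalence.to T-∨ v
  ... | inj₁ e = from-edge (home-away refl refl) (edge-sound _ _ _ e)
  ... | inj₂ e = from-edge (away-home refl refl) (edge-sound _ _ _ e)

  realises? : ∀ A B r g → Dec (Realises A B r g)
  realises? A B r g =
    map′ to from (((role (home g) ≟ʳ A ×-dec role (away g) ≟ʳ B)
                   ⊎-dec (role (home g) ≟ʳ B ×-dec role (away g) ≟ʳ A)) ×-dec round g ≟ r)
    where
    Oriented : Set
    Oriented = ((role (home g) ≡ A × role (away g) ≡ B) ⊎ (role (home g) ≡ B × role (away g) ≡ A))
               × round g ≡ r
    to : Oriented → Realises A B r g
    to (inj₁ (hA , aB) , r≡) = realises _ _ (home-away refl refl) hA aB r≡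
    to (inj₂ (hB , aA) , r≡) = realises _ _ (away-home refl refl) aA hB r≡
    from : Realises A B r g → Oriented
    from (realises _ _ (home-away refl refl) uA wB r≡) = inj₁ (uA , wB) , r≡
    from (realises _ _ (away-home refl refl) uA wB r≡) = inj₂ (wB , uA) , r≡

module Charging {n m : ℕ} (φ : Formula n m) (ord : AppearanceOrder φ) (n' : ℕ)
                (seeding : Fin (2 ^ n') → ℕ) (seeding-injective : Injective _≡_ _≡_ seeding)
                (seeding-bounded : ∀ s → seeding s < 2 ^ n') where

  open Strength n m n'
  open Games φ ord n'
  open Bracket n' seeding seeding-injective

  schedule : List Match
  schedule = matches n' seeding

  player<N : ∀ {g p} → g ∈ schedule → Plays p g → p < N
  player<N g∈ p∈g with players-seeded n' seeding g∈ p∈g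
  ... | s , refl = seeding-bounded s

  role-clash : ∀ {a b c x t} → a ≡ b → role a ≡ cl c → role b ≡ var x t → ⊥
  role-clash refl ra rb with trans (sym ra) rb
  ... | ()

  same-variable⇒≡ : ∀ {g₁ g₂ x p₁ p₂} → g₁ ∈ schedule → g₂ ∈ schedule →
    Realises (var x zero) (literalRole x p₁) 1 g₁ → Realises (var x zero) (literalRole x p₂) 1 g₂ → g₁ ≡ g₂
  same-variable⇒≡ g₁∈ g₂∈ (realises u₁ _ J₁ ru₁ _ r₁) (realises u₂ _ J₂ ru₂ _ r₂)
    with same-var-role⇒≡ (player<N g₁∈ (joins-plays₁ J₁)) (player<N g₂∈ (joins-plays₁ J₂)) ru₁ ru₂
  ... | refl = same-round⇒≡ g₁∈ g₂∈ (joins-plays₁ J₁) (joins-plays₁ J₂) (trans r₁ (sym r₂))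

  same-clause⇒≡ : ∀ {g₁ g₂ c x₁ x₂ t₁ t₂ r₁ r₂} → g₁ ∈ schedule → g₂ ∈ schedule →
    Realises (cl c) (var x₁ t₁) r₁ g₁ → Realises (cl c) (var x₂ t₂) r₂ g₂ → g₁ ≡ g₂
  same-clause⇒≡ g₁∈ g₂∈ (realises u₁ _ J₁ ru₁ rw₁ _) (realises u₂ _ J₂ ru₂ rw₂ _)
    with same-clause-role⇒≡ (player<N g₁∈ (joins-plays₁ J₁)) (player<N g₂∈ (joins-plays₁ J₂)) ru₁ ru₂
  ... | refl = beaten-twice⇒≡ g₁∈ g₂∈ (joins-plays₁ J₁) (joins-plays₁ J₂)
                 (weaker-loses J₁ (literal-beats-clause ru₁ rw₁)) (weaker-loses J₂ (literal-beats-clause ru₂ rw₂))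

  variable-match-excludes-clause-match : ∀ {g₁ g₂ x p c r} → g₁ ∈ schedule → g₂ ∈ schedule →
    Realises (var x zero) (literalRole x p) 1 g₁ → Realises (cl c) (literalRole x p) (suc r) g₂ → ⊥
  variable-match-excludes-clause-match g₁∈ g₂∈ (realises u₁ w₁ J₁ ru₁ rw₁ r₁) (realises u₂ w₂ J₂ ru₂ rw₂ r₂)
    with same-var-role⇒≡ (player<N g₁∈ (joins-plays₂ J₁)) (player<N g₂∈ (joins-plays₂ J₂)) rw₁ rw₂
  ... | refl with beaten-in-later⇒≡ g₁∈ g₂∈ (joins-plays₂ J₁) (joins-plays₂ J₂)
                    (weaker-loses (joins-swap J₁) (variable-beats-literal ru₁ rw₁))
                    (subst₂ _≤_ (sym r₁) (sym r₂) (s≤s z≤n))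
  ... | refl with joins-players J₁ (joins-plays₁ J₂)
  ...   | inj₁ u₂≡u₁ = role-clash u₂≡u₁ ru₂ ru₁
  ...   | inj₂ u₂≡w₁ = role-clash u₂≡w₁ ru₂ rw₁

  PlayedIn : Fin n → Bool → Fin 3 → Match → Set
  PlayedIn x p a g = T (isValueOne g) × ∃[ c ] Realises (cl c) (literalRole x p) (suc (toℕ a)) g

  Played : Fin n → Bool → Fin 3 → Set
  Played x p a = Any.Any (PlayedIn x p a) schedule

  AnyPlayed : Fin n → Bool → Set
  AnyPlayed x p = ∃[ a ] Played x p a

  TwoPlayed : Fin n → Bool → Set
  TwoPlayed x p = ∃[ a ] ∃[ a′ ] a ≢ a′ × Played x p a × Played x p a′

  played? : ∀ x p a → Dec (Played x p a)
  played? x p a = Any.any? (λ g → T? (isValueOne g) ×-dec any? λ c → realises? _ _ _ g) schedule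

  anyPlayed? : ∀ x p → Dec (AnyPlayed x p)
  anyPlayed? x p = any? (played? x p)

  twoPlayed? : ∀ x p → Dec (TwoPlayed x p)
  twoPlayed? x p = any? λ a → any? λ a′ → ¬? (a ≟ᶠ a′) ×-dec played? x p a ×-dec played? x p a′

  playedIn⇒occurrence : ∀ {x p a g} → PlayedIn x p a g →
    ∃[ c ] ∃[ b ] litVar φ c b ≡ x × litPos φ c b ≡ p × app ord c b ≡ a
  playedIn⇒occurrence {g = g} (v , c , realises u w J ru rw r≡) with classify g v
  ... | variable-match _ _ (realises u′ w′ J′ ru′ rw′ _) with joins-players J′ (joins-plays₁ J)
  ...   | inj₁ u≡u′ = ⊥-elim (role-clash u≡u′ ru ru′)
  ...   | inj₂ u≡w′ = ⊥-elim (role-clash u≡w′ ru rw′)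
  playedIn⇒occurrence {g = g} (v , c , realises u w J ru rw r≡) | clause-match c′ b (realises u′ w′ J′ ru′ rw′ r≡′)
    with joins-players J′ (joins-plays₂ J)
  ... | inj₁ w≡u′ = ⊥-elim (role-clash (sym w≡u′) ru′ rw)
  ... | inj₂ refl with literalRole-injective (trans (sym rw′) rw)
  ...   | var≡ , pos≡ = c′ , b , var≡ , pos≡ , toℕ-injective (suc-injective (trans (sym r≡′) r≡))

  played⇒occurrence : ∀ {x p a} → Played x p a →
    ∃[ c ] ∃[ b ] litVar φ c b ≡ x × litPos φ c b ≡ p × app ord c b ≡ a
  played⇒occurrence P with find P
  ... | _ , _ , inG = playedIn⇒occurrence inG

  opposite-literals-differ : ∀ {x a} → Played x true a → Played x false a → ⊥
  opposite-literals-differ P⁺ P⁻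
    with played⇒occurrence {p = true} P⁺ | played⇒occurrence {p = false} P⁻
  ... | c , b , var≡ , pos≡ , app≡ | c′ , b′ , var≡′ , pos≡′ , app≡′
    with injective ord c b c′ b′ (trans var≡ (sym var≡′)) (trans app≡ (sym app≡′))
  ... | refl with trans (sym pos≡) pos≡′
  ...   | ()

  not-two-played-both-ways : ∀ {x} → TwoPlayed x true → TwoPlayed x false → ⊥
  not-two-played-both-ways (a₁ , a₁′ , a₁≢a₁′ , P₁ , P₁′) (a₂ , a₂′ , a₂≢a₂′ , P₂ , P₂′)
    = let i , j , i<j , same = pigeonhole ≤-refl appearance in collision i j i<j same
    where
    appearance : Fin 4 → Fin 3
    appearance zero                   = a₁
    appearance (suc zero)             = a₁′
    appearance (suc (suc zero))       = a₂
    appearance (suc (suc (suc zero))) = a₂′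
    collision : ∀ i j → i <ᶠ j → appearance i ≡ appearance j → ⊥
    collision zero             (suc zero)             _ e = a₁≢a₁′ e
    collision zero             (suc (suc zero))       _ e = opposite-literals-differ P₁ (subst (Played _ false) (sym e) P₂)
    collision zero             (suc (suc (suc zero))) _ e = opposite-literals-differ P₁ (subst (Played _ false) (sym e) P₂′)
    collision (suc zero)       (suc (suc zero))       _ e = opposite-literals-differ P₁′ (subst (Played _ false) (sym e) P₂)
    collision (suc zero)       (suc (suc (suc zero))) _ e = opposite-literals-differ P₁′ (subst (Played _ false) (sym e) P₂′)
    collision (suc (suc zero)) (suc (suc (suc zero))) _ e = a₂≢a₂′ e
    collision (suc zero)          (suc zero)             (s≤s ())
    collision (suc (suc _))       (suc zero)             (s≤s ())
    collision (suc (suc _))       (suc (suc zero))       (s≤s (s≤s ()))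
    collision (suc (suc (suc _))) (suc (suc (suc zero))) (s≤s (s≤s (s≤s ())))

  Rule : Fin n → Set
  Rule x = TwoPlayed x true ⊎ ¬ AnyPlayed x false

  rule? : ∀ x → Dec (Rule x)
  rule? x = twoPlayed? x true ⊎-dec ¬? (anyPlayed? x false)

  -- Opaque because unfolding the decision procedure makes type checking very slow.
  opaque
    α : Assignment n
    α x = isYes (rule? x)

    α-true : ∀ {x} → α x ≡ true → Rule x
    α-true {x} e = toWitness {a? = rule? x} (Equivalence.from T-≡ e)

    α-false : ∀ {x} → α x ≡ false → ¬ Rule x
    α-false {x} e = toWitnessFalse {a? = rule? x} (Equivalence.from T-not-≡ e)

  falsified⇒both-played : ∀ {x p a} → Played x p a → α x ≢ p → ∀ q → AnyPlayed x q
  falsified⇒both-played {p = true}  P _ true  = _ , P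
  falsified⇒both-played {p = false} P _ false = _ , P
  falsified⇒both-played {x} {p = true} P α≢p false =
    decidable-stable (anyPlayed? x false) (λ none → α-false (¬-not α≢p) (inj₂ none))
  falsified⇒both-played {p = false} P α≢p true with α-true (¬-not α≢p)
  ... | inj₁ (a , _ , _ , Pa , _) = a , Pa
  ... | inj₂ none = ⊥-elim (none (_ , P))

  falsified⇒not-two-played : ∀ {x p} → α x ≢ p → ¬ TwoPlayed x p
  falsified⇒not-two-played {p = true}  α≢p two = α-false (¬-not α≢p) (inj₁ two)
  falsified⇒not-two-played {p = false} α≢p two⁻ with α-true (¬-not α≢p)
  ... | inj₁ two⁺ = not-two-played-both-ways two⁺ two⁻
  ... | inj₂ none = none (let (a , _ , _ , P , _) = two⁻ in a , P)

  clause-match⇒played : ∀ {g c b} → g ∈ schedule → T (isValueOne g) →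
    Realises (cl c) (occurrenceRole c b) (occurrenceRound c b) g →
    Played (litVar φ c b) (litPos φ c b) (app ord c b)
  clause-match⇒played g∈ v R = lose g∈ (v , _ , R)

  variable-match⇒not-played : ∀ {g x p} → g ∈ schedule →
    Realises (var x zero) (literalRole x p) 1 g → ¬ AnyPlayed x p
  variable-match⇒not-played g∈ R (a , P) with find P
  ... | _ , g′∈ , (_ , _ , R′) = variable-match-excludes-clause-match g∈ g′∈ R R′

  falsified-pair⇒≡ : ∀ {g₁ g₂ c₁ b₁ c₂ b₂} → g₁ ∈ schedule → g₂ ∈ schedule →
    T (isValueOne g₁) → T (isValueOne g₂) →
    Realises (cl c₁) (occurrenceRole c₁ b₁) (occurrenceRound c₁ b₁) g₁ →
    Realises (cl c₂) (occurrenceRole c₂ b₂) (occurrenceRound c₂ b₂) g₂ →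
    litVar φ c₁ b₁ ≡ litVar φ c₂ b₂ →
    α (litVar φ c₁ b₁) ≢ litPos φ c₁ b₁ → α (litVar φ c₂ b₂) ≢ litPos φ c₂ b₂ → g₁ ≡ g₂
  falsified-pair⇒≡ {c₁ = c₁} {b₁} {c₂} {b₂} g₁∈ g₂∈ v₁ v₂ R₁ R₂ var≡ unsat₁ unsat₂
    with app ord c₁ b₁ ≟ᶠ app ord c₂ b₂
  ... | yes app≡ with injective ord c₁ b₁ c₂ b₂ var≡ app≡
  ...   | refl = same-clause⇒≡ g₁∈ g₂∈ R₁ R₂
  falsified-pair⇒≡ {c₁ = c₁} {b₁} {c₂} {b₂} g₁∈ g₂∈ v₁ v₂ R₁ R₂ var≡ unsat₁ unsat₂ | no app≢ =
    ⊥-elim (falsified⇒not-two-played unsat₁ (_ , _ , app≢ , clause-match⇒played g₁∈ v₁ R₁ , played₂))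
    where
    pos≡ : litPos φ c₁ b₁ ≡ litPos φ c₂ b₂
    pos≡ = not-injective (trans (sym (¬-not unsat₁)) (trans (cong α var≡) (¬-not unsat₂)))
    played₂ : Played (litVar φ c₁ b₁) (litPos φ c₁ b₁) (app ord c₂ b₂)
    played₂ = subst₂ (λ x p → Played x p _) (sym var≡) (sym pos≡) (clause-match⇒played g₂∈ v₂ R₂)

  Token : Set
  Token = Fin n ⊎ Fin m

  clauseCharge : Fin m → Fin 2 → Token
  clauseCharge c b with α (litVar φ c b) ≟ᵇ litPos φ c b
  ... | yes _ = inj₂ c
  ... | no _  = inj₁ (litVar φ c b)

  clauseCharge-cases : ∀ c b →
      (α (litVar φ c b) ≡ litPos φ c b × clauseCharge c b ≡ inj₂ c)
    ⊎ (α (litVar φ c b) ≢ litPos φ c b × clauseCharge c b ≡ inj₁ (litVar φ c b))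
  clauseCharge-cases c b with α (litVar φ c b) ≟ᵇ litPos φ c b
  ... | yes sat   = inj₁ (sat , refl)
  ... | no  unsat = inj₂ (unsat , refl)

  charge : ∀ {g} → ValueOneMatch g → Token
  charge (variable-match x _ _) = inj₁ x
  charge (clause-match c b _)   = clauseCharge c b

  variable-vs-clause-charge : ∀ {g₁ g₂ x p c b} → g₁ ∈ schedule → g₂ ∈ schedule → T (isValueOne g₂) →
    Realises (var x zero) (literalRole x p) 1 g₁ →
    Realises (cl c) (occurrenceRole c b) (occurrenceRound c b) g₂ → inj₁ x ≢ clauseCharge c b
  variable-vs-clause-charge {p = p} {c} {b} g₁∈ g₂∈ v₂ R₁ R₂ e with clauseCharge-cases c b
  ... | inj₁ (_ , q) with trans e q
  ...   | ()
  variable-vs-clause-charge {p = p} {c} {b} g₁∈ g₂∈ v₂ R₁ R₂ e | inj₂ (unsat , q)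
    with inj₁-injective (trans e q)
  ... | refl = variable-match⇒not-played g₁∈ R₁ (falsified⇒both-played (clause-match⇒played g₂∈ v₂ R₂) unsat p)

  charge-injective : ∀ {g₁ g₂} → g₁ ∈ schedule → g₂ ∈ schedule → T (isValueOne g₁) → T (isValueOne g₂) →
    (K₁ : ValueOneMatch g₁) (K₂ : ValueOneMatch g₂) → charge K₁ ≡ charge K₂ → g₁ ≡ g₂
  charge-injective g₁∈ g₂∈ _ _ (variable-match x _ R₁) (variable-match .x _ R₂) refl =
    same-variable⇒≡ g₁∈ g₂∈ R₁ R₂
  charge-injective g₁∈ g₂∈ _ v₂ (variable-match _ _ R₁) (clause-match _ _ R₂) e =
    ⊥-elim (variable-vs-clause-charge g₁∈ g₂∈ v₂ R₁ R₂ e)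
  charge-injective g₁∈ g₂∈ v₁ _ (clause-match _ _ R₁) (variable-match _ _ R₂) e =
    ⊥-elim (variable-vs-clause-charge g₂∈ g₁∈ v₁ R₂ R₁ (sym e))
  charge-injective g₁∈ g₂∈ v₁ v₂ (clause-match c₁ b₁ R₁) (clause-match c₂ b₂ R₂) e
    with clauseCharge-cases c₁ b₁ | clauseCharge-cases c₂ b₂
  ... | inj₁ (_ , q₁) | inj₁ (_ , q₂) with inj₂-injective (trans (sym q₁) (trans e q₂))
  ...   | refl = same-clause⇒≡ g₁∈ g₂∈ R₁ R₂
  charge-injective _ _ _ _ _ _ e | inj₁ (_ , q₁) | inj₂ (_ , q₂) with trans (sym q₁) (trans e q₂)
  ...   | ()
  charge-injective _ _ _ _ _ _ e | inj₂ (_ , q₁) | inj₁ (_ , q₂) with trans (sym q₁) (trans e q₂)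
  ...   | ()
  charge-injective g₁∈ g₂∈ v₁ v₂ (clause-match _ _ R₁) (clause-match _ _ R₂) e
    | inj₂ (unsat₁ , q₁) | inj₂ (unsat₂ , q₂) =
    falsified-pair⇒≡ g₁∈ g₂∈ v₁ v₂ R₁ R₂ (inj₁-injective (trans (sym q₁) (trans e q₂))) unsat₁ unsat₂

  literal-satisfied : ∀ (l : Literal n) → α (proj₁ l) ≡ proj₂ l → T (litSat α l)
  literal-satisfied (x , true)  e = Equivalence.from T-≡ e
  literal-satisfied (x , false) e = Equivalence.from T-not-≡ e

  clause-satisfied : ∀ c b → α (litVar φ c b) ≡ litPos φ c b → T (clauseSat φ α c)
  clause-satisfied c zero       e = Equivalence.from T-∨ (inj₁ (literal-satisfied (φ c zero) e))
  clause-satisfied c (suc zero) e = Equivalence.from T-∨ (inj₂ (literal-satisfied (φ c (suc zero)) e))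

  satisfiedClauses : List (Fin m)
  satisfiedClauses = filter (T? ∘ clauseSat φ α) (allFin m)

  tokens : List Token
  tokens = map inj₁ (allFin n) ++ map inj₂ satisfiedClauses

  length-tokens : length tokens ≡ n + numSat φ α
  length-tokens = begin
      length tokens
    ≡⟨ length-++ (map inj₁ (allFin n)) ⟩
      length (map inj₁ (allFin n)) + length (map inj₂ satisfiedClauses)
    ≡⟨ cong₂ _+_ (trans (length-map inj₁ (allFin n)) (length-tabulate id)) (length-map inj₂ satisfiedClauses) ⟩
      n + length satisfiedClauses
    ≡⟨ cong (n +_) (sum-indicator≡length-filter (clauseSat φ α) (allFin m)) ⟨
      n + numSat φ α
    ∎
    where open ≡-Reasoning

  charge∈tokens : ∀ {g} (K : ValueOneMatch g) → charge K ∈ tokens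
  charge∈tokens (variable-match x _ _) = ∈-++⁺ˡ (∈-map⁺ inj₁ (∈-allFin x))
  charge∈tokens (clause-match c b _) with clauseCharge-cases c b
  ... | inj₁ (sat , q) rewrite q =
    ∈-++⁺ʳ (map inj₁ (allFin n)) (∈-map⁺ inj₂ (∈-filter⁺ (T? ∘ clauseSat φ α) (∈-allFin c) (clause-satisfied c b sat)))
  ... | inj₂ (_ , q) rewrite q = ∈-++⁺ˡ (∈-map⁺ inj₁ (∈-allFin _))

  valueOneMatches : List Match
  valueOneMatches = filter (T? ∘ isValueOne) schedule

  valueOneMatches≤ : length valueOneMatches ≤ n + numSat φ α
  valueOneMatches≤ = subst (_ ≤_) length-tokens
    (injection⇒length≤ (≡-dec _≟ᶠ_ _≟ᶠ_) (filter⁺ (T? ∘ isValueOne) matches-unique)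
       chargeOf (λ {g} {h} i j → charge-injective (∈-schedule i) (∈-schedule j) (isValue i) (isValue j)
                                   (classify g (isValue i)) (classify h (isValue j)))
       (λ {g} i → charge∈tokens (classify g (isValue i))))
    where
    ∈-schedule : ∀ {g} → g ∈ valueOneMatches → g ∈ schedule
    ∈-schedule i = proj₁ (∈-filter⁻ (T? ∘ isValueOne) {xs = schedule} i)
    isValue : ∀ {g} → g ∈ valueOneMatches → T (isValueOne g)
    isValue i = proj₂ (∈-filter⁻ (T? ∘ isValueOne) {xs = schedule} i)
    chargeOf : ∀ {g} → g ∈ valueOneMatches → Token
    chargeOf {g} i = charge (classify g (isValue i))

lemma2 : ∀ {n m} (φ : Formula n m) (ord : AppearanceOrder φ) (n' : ℕ) →
         IsDepth n n' → (k' : ℕ) → (σ : Fin (2 ^ n') ↔ Fin (2 ^ n')) →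
         k' ≤ tournamentValue φ ord n' (Inverse.from σ) →
         Σ (Assignment n) λ α → k' ∸ n ≤ numSat φ α
-- The bound holds for every bracket depth; IsDepth only fixes the size of the instance.
lemma2 {n} φ ord n' _ k' σ k'≤value = α , m≤n+o⇒m∸n≤o k' n (begin
    k'                                                   ≤⟨ k'≤value ⟩
    tournamentValue φ ord n' (Inverse.from σ)            ≡⟨ blockValue≡sum-matches (gameValue φ ord n') n' seeding ⟩
    sum (map (matchValue (gameValue φ ord n')) schedule) ≡⟨ sum-indicator≡length-filter isValueOne schedule ⟩
    length valueOneMatches                               ≤⟨ valueOneMatches≤ ⟩
    n + numSat φ α                                       ∎)
  where
  open ≤-Reasoning
  seeding : Fin (2 ^ n') → ℕ
  seeding s = toℕ (Inverse.from σ s)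
  seeding-injective : Injective _≡_ _≡_ seeding
  seeding-injective = Injection.injective (↔⇒↣ (↔-sym σ)) ∘ toℕ-injective
  open Charging φ ord n' seeding seeding-injective (λ s → toℕ<n (Inverse.from σ s))
  open Games φ ord n' using (isValueOne)
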